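{- (1) Every infinite binary word contains a palindromic factor of length greater than $3$. (2) There exist infinite binary words containing no palindromic factor of length greater than $4$, but every such word is ultimately periodic. (3) There exists a uniformly recurrent aperiodic binary infinite word, closed under reversal, whose longest palindromic factor has length $5$.
   Context: An infinite word is ultimately periodic if $\omega_{i+p}=\omega_i$ for some $p\ge1$ and all sufficiently large $i$, aperiodic otherwise. It is uniformly recurrent if every factor occurs infinitely often with bounded gaps between consecutive occurrences. It is closed under reversal if the reversal of every factor is again a factor. -}

module Defs where

open import Data.Bool using (Bool)
open import Data.Nat using (ℕ; zero; suc; _+_; _≤_; _≥_)
open import Data.List using (List; []; _∷_; length; reverse)
open import Data.Product using (Σ; ∃; _×_)
open import Relation.Binary.PropositionalEquality using (_≡_)
open import Relation.Nullary using (¬_)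

Word : Set
Word = ℕ → Bool

factorAt : Word → ℕ → ℕ → List Bool
factorAt w i zero = []
factorAt w i (suc n) = w i ∷ factorAt w (suc i) n

OccursAt : Word → List Bool → ℕ → Set
OccursAt w u i = factorAt w i (length u) ≡ u

IsFactor : Word → List Bool → Set
IsFactor w u = ∃ λ i → OccursAt w u i

Palindrome : List Bool → Set
Palindrome u = reverse u ≡ u

PalFactor : Word → List Bool → Set
PalFactor w u = IsFactor w u × Palindrome u

UltimatelyPeriodic : Word → Set
UltimatelyPeriodic w =
  ∃ λ p → p ≥ 1 × ∃ λ N → ∀ i → i ≥ N → w (i + p) ≡ w i

Aperiodic : Word → Set
Aperiodic w = ¬ UltimatelyPeriodic w

UniformlyRecurrent : Word → Set
UniformlyRecurrent w =
  ∀ u → IsFactor w u →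
    ∃ λ g → ∀ i → ∃ λ j → i ≤ j × j ≤ i + g × OccursAt w u j

ClosedUnderReversal : Word → Set
ClosedUnderReversal w = ∀ u → IsFactor w u → IsFactor w (reverse u)

PalBounded : Word → ℕ → Set
PalBounded w n = ∀ u → PalFactor w u → length u ≤ n

module Submission where

-- (1) and (2) are finite checks: every binary word of length 9 has a palindromic factor of length 4
-- or 5, and in every binary word of length 11 without palindromic factors of length 5 or 6 the bits
-- at positions 2 and 8 agree, which forces period 6 from position 2 on. A palindrome of length n + 2
-- contains one of length n, so excluding palindromes of lengths b + 1 and b + 2 bounds all of them by b.
--
-- For (3) take ω = φ(σ∞), where σ∞ is the fixed point of σ : A ↦ ACA, B ↦ BDB, C ↦ CAD, D ↦ CBD and
-- φ codes each letter by a block of six bits. The involution θ (A ↔ B, C ↔ D) satisfies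
-- σ(θ x) = reverse (θ (σ x)) and φ(θ x) = reverse (φ x), so φσᵏ(B) is the mirror image of φσᵏ(A); as both
-- occur in ω, ω is closed under reversal. Every σ³(x) contains A, so every factor of ω recurs within
-- bounded gaps. A period 3q of σ∞ descends to q, while a period ≢ 0 mod 3 would confine σ∞ to {A, B};
-- so ω is aperiodic. Finally only eight pairs of letters are adjacent in σ∞, and checking the
-- corresponding twelve-bit windows excludes palindromes of length 6 and 7 in ω, while 00100 occurs.


open import Defs
open import Data.Bool using (Bool; true; false) renaming (_≟_ to _≟ᵇ_)
open import Data.Empty using (⊥-elim)
open import Data.Fin using (Fin; zero; suc; toℕ)
open import Data.Fin.Properties using (any?; toℕ<n)
open import Data.List using (List; []; _∷_; _++_; _∷ʳ_; length; reverse; take; drop)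
open import Data.List.Properties
  using (≡-dec; reverse-++; unfold-reverse; ∷ʳ-injectiveˡ; ∷-injective; ∷-injectiveˡ; length-reverse)
open import Data.Nat using (ℕ; zero; suc; _+_; _*_; _∸_; _^_; _≤_; _<_; _≥_; _>_; z≤n; s≤s; z<s; s<s; NonZero; _≤?_)
open import Data.Nat.DivMod
  using (_/_; _%_; _divMod_; result; +-distrib-/; m<n⇒m%n≡m; m*n%n≡0; m<n⇒m/n≡0; m*n/n≡m; [m+kn]%n≡m%n;
         m≡m%n+[m/n]*n; m%n<n; m/n<m; m<n*o⇒m/o<n; m/n*n≤m)
open import Data.Nat.Induction using (<-rec)
open import Data.Nat.Properties
open import Data.Nat.Solver using (module +-*-Solver)
open import Data.Product using (∃; _×_; _,_; proj₁; proj₂)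
open import Data.Sum using (_⊎_; inj₁; inj₂; [_,_])
open import Level using (0ℓ)
open import Relation.Binary.PropositionalEquality
  using (_≡_; _≢_; refl; sym; trans; cong; cong₂; subst; subst₂; module ≡-Reasoning)
open import Relation.Nullary using (¬_; yes; no)
open import Relation.Nullary.Decidable using (Dec; map′; _×-dec_; _⊎-dec_; ¬?; from-yes)
open import Relation.Unary using (Pred; Decidable)

open +-*-Solver
open ≡-Reasoning

factorAt-∷ʳ : ∀ w i n → factorAt w i (suc n) ≡ factorAt w i n ∷ʳ w (i + n)
factorAt-∷ʳ w i zero rewrite +-identityʳ i = refl
factorAt-∷ʳ w i (suc n) rewrite factorAt-∷ʳ w (suc i) n | +-suc i n = refl

length-factorAt : ∀ w i n → length (factorAt w i n) ≡ n
length-factorAt w i zero = refl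
length-factorAt w i (suc n) = cong suc (length-factorAt w (suc i) n)

factorAt-occurs : ∀ w i n → OccursAt w (factorAt w i n) i
factorAt-occurs w i n = cong (factorAt w i) (length-factorAt w i n)

factorAt-++ : ∀ w i m n → factorAt w i (m + n) ≡ factorAt w i m ++ factorAt w (i + m) n
factorAt-++ w i zero n = cong (λ j → factorAt w j n) (sym (+-identityʳ i))
factorAt-++ w i (suc m) n =
  cong (w i ∷_) (trans (factorAt-++ w (suc i) m n) (cong (λ j → factorAt w (suc i) m ++ factorAt w j n) (sym (+-suc i m))))

drop-factorAt : ∀ w k s n → drop s (factorAt w k (s + n)) ≡ factorAt w (k + s) n
drop-factorAt w k zero n = cong (λ j → factorAt w j n) (sym (+-identityʳ k))
drop-factorAt w k (suc s) n = trans (drop-factorAt w (suc k) s n) (cong (λ j → factorAt w j n) (sym (+-suc k s)))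

take-factorAt : ∀ w k n d → take n (factorAt w k (n + d)) ≡ factorAt w k n
take-factorAt w k zero d = refl
take-factorAt w k (suc n) d = cong (w k ∷_) (take-factorAt w (suc k) n d)

take-drop-factorAt : ∀ w k {s n N} → s + n ≤ N → take n (drop s (factorAt w k N)) ≡ factorAt w (k + s) n
take-drop-factorAt w k {s} {n} s+n≤N with m≤n⇒∃[o]m+o≡n s+n≤N
... | d , refl = begin
  take n (drop s (factorAt w k (s + n + d)))   ≡⟨ cong (λ m → take n (drop s (factorAt w k m))) (+-assoc s n d) ⟩
  take n (drop s (factorAt w k (s + (n + d)))) ≡⟨ cong (take n) (drop-factorAt w k s (n + d)) ⟩
  take n (factorAt w (k + s) (n + d))         ≡⟨ take-factorAt w (k + s) n d ⟩
  factorAt w (k + s) n                         ∎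

factorAt-cong : ∀ {v w : Word} a b n → (∀ t → t < n → v (a + t) ≡ w (b + t)) → factorAt v a n ≡ factorAt w b n
factorAt-cong a b zero agree = refl
factorAt-cong {v} {w} a b (suc n) agree = cong₂ _∷_ head (factorAt-cong (suc a) (suc b) n tail)
  where
  head : v a ≡ w b
  head = subst₂ (λ x y → v x ≡ w y) (+-identityʳ a) (+-identityʳ b) (agree 0 (s≤s z≤n))
  tail : ∀ t → t < n → v (suc a + t) ≡ w (suc b + t)
  tail t t<n = subst₂ (λ x y → v x ≡ w y) (+-suc a t) (+-suc b t) (agree (suc t) (s≤s t<n))

factorAt-reverse : ∀ {v w : Word} a b n → (∀ t t′ → t + suc t′ ≡ n → v (a + t) ≡ w (b + t′)) →
                   factorAt v a n ≡ reverse (factorAt w b n)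
factorAt-reverse a b zero mirror = refl
factorAt-reverse {v} {w} a b (suc n) mirror = begin
  v a ∷ factorAt v (suc a) n                 ≡⟨ cong₂ _∷_ head (factorAt-reverse (suc a) b n tail) ⟩
  w (b + n) ∷ reverse (factorAt w b n)       ≡⟨ reverse-++ (factorAt w b n) (w (b + n) ∷ []) ⟨
  reverse (factorAt w b n ∷ʳ w (b + n))      ≡⟨ cong reverse (factorAt-∷ʳ w b n) ⟨
  reverse (factorAt w b (suc n))             ∎
  where
  head : v a ≡ w (b + n)
  head = subst (λ x → v x ≡ w (b + n)) (+-identityʳ a) (mirror 0 n refl)
  tail : ∀ t t′ → t + suc t′ ≡ n → v (suc a + t) ≡ w (b + t′)
  tail t t′ eq = subst (λ x → v x ≡ w (b + t′)) (+-suc a t) (mirror (suc t) t′ (cong suc eq))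

palindrome-inner : ∀ w i n → Palindrome (factorAt w i (suc (suc n))) → Palindrome (factorAt w (suc i) n)
palindrome-inner w i n pal = ∷ʳ-injectiveˡ (reverse v) v (proj₂ (∷-injective mirrored))
  where
  v = factorAt w (suc i) n
  outer : factorAt w i (suc (suc n)) ≡ w i ∷ (v ∷ʳ w (suc i + n))
  outer = cong (w i ∷_) (factorAt-∷ʳ w (suc i) n)
  mirrored : w (suc i + n) ∷ (reverse v ∷ʳ w i) ≡ w i ∷ (v ∷ʳ w (suc i + n))
  mirrored = begin
    w (suc i + n) ∷ (reverse v ∷ʳ w i)      ≡⟨ cong (_∷ʳ w i) (reverse-++ v (w (suc i + n) ∷ [])) ⟨
    reverse (v ∷ʳ w (suc i + n)) ∷ʳ w i     ≡⟨ unfold-reverse (w i) (v ∷ʳ w (suc i + n)) ⟨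
    reverse (w i ∷ (v ∷ʳ w (suc i + n)))    ≡⟨ cong reverse outer ⟨
    reverse (factorAt w i (suc (suc n)))    ≡⟨ pal ⟩
    factorAt w i (suc (suc n))              ≡⟨ outer ⟩
    w i ∷ (v ∷ʳ w (suc i + n))              ∎

palindrome-centre : ∀ w a n i → Palindrome (factorAt w i (n + a)) →
                    ∃ λ j → Palindrome (factorAt w j a) ⊎ Palindrome (factorAt w j (suc a))
palindrome-centre w a zero i pal = i , inj₁ pal
palindrome-centre w a (suc zero) i pal = i , inj₂ pal
palindrome-centre w a (suc (suc n)) i pal = palindrome-centre w a n (suc i) (palindrome-inner w i (n + a) pal)

NoPalOfLength : Word → ℕ → Set
NoPalOfLength w n = ∀ j → ¬ Palindrome (factorAt w j n)

palBounded : ∀ {w} b → NoPalOfLength w (suc b) → NoPalOfLength w (suc (suc b)) → PalBounded w b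
palBounded {w} b noPal₁ noPal₂ u ((i , occ) , pal) with length u ≤? b
... | yes ≤b = ≤b
... | no ≰b with m≤n⇒∃[o]m+o≡n (≰⇒> ≰b)
...   | d , len = ⊥-elim ([ noPal₁ j , noPal₂ j ] centre)
  where
  long : Palindrome (factorAt w i (d + suc b))
  long = subst (λ m → Palindrome (factorAt w i m)) (trans (sym len) (+-comm (suc b) d)) (subst Palindrome (sym occ) pal)
  j = proj₁ (palindrome-centre w (suc b) d i long)
  centre = proj₂ (palindrome-centre w (suc b) d i long)

palindromicFactor : ∀ w {j n} → Palindrome (factorAt w j n) → PalFactor w (factorAt w j n)
palindromicFactor w {j} {n} pal = (j , factorAt-occurs w j n) , pal

palBounded⇒noPal : ∀ {w b n} → PalBounded w b → b < n → ¬ ∃ λ j → Palindrome (factorAt w j n)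
palBounded⇒noPal {w} {n = n} bounded b<n (j , pal) =
  <⇒≱ b<n (subst (_≤ _) (length-factorAt w j n) (bounded _ (palindromicFactor w pal)))

-- Palindromes in short words, by exhaustive search

palindrome? : Decidable Palindrome
palindrome? u = ≡-dec _≟ᵇ_ (reverse u) u

PalWindow : ℕ → ℕ → List Bool → Set
PalWindow n c l = ∃ λ (s : Fin c) → Palindrome (take n (drop (toℕ s) l))

palWindow? : ∀ n c → Decidable (PalWindow n c)
palWindow? n c l = any? (λ s → palindrome? (take n (drop (toℕ s) l)))

∀-ofLength? : {P : Pred (List Bool) 0ℓ} → Decidable P → ∀ n → Dec (∀ l → length l ≡ n → P l)
∀-ofLength? P? zero = map′ (λ { p [] refl → p }) (λ all → all [] refl) (P? [])
∀-ofLength? P? (suc n) = map′ combine split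
  (∀-ofLength? (λ l → P? (true ∷ l)) n ×-dec ∀-ofLength? (λ l → P? (false ∷ l)) n)
  where
  combine = λ { (pt , pf) (true ∷ l) len → pt l (suc-injective len)
              ; (pt , pf) (false ∷ l) len → pf l (suc-injective len) }
  split = λ all → (λ l len → all (true ∷ l) (cong suc len)) , (λ l len → all (false ∷ l) (cong suc len))

palWindow-factorAt : ∀ w k {n c N} → c + n ≤ suc N → PalWindow n c (factorAt w k N) →
                     ∃ λ j → Palindrome (factorAt w j n)
palWindow-factorAt w k {n} {N = N} c+n≤1+N (s , pal) = k + toℕ s , subst Palindrome (take-drop-factorAt w k fits) pal
  where
  fits : toℕ s + n ≤ N
  fits = ≤-pred (≤-trans (+-monoˡ-< n (toℕ<n s)) c+n≤1+N)

-- Opaque, so that uses of these facts never unfold the exhaustive search.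
opaque
  palWindowIn9 : ∀ l → length l ≡ 9 → PalWindow 4 6 l ⊎ PalWindow 5 5 l
  palWindowIn9 = from-yes (∀-ofLength? (λ l → palWindow? 4 6 l ⊎-dec palWindow? 5 5 l) 9)

longPalFactor : (w : Word) → ∃ λ u → PalFactor w u × length u > 3
longPalFactor w with palWindowIn9 (factorAt w 0 9) (length-factorAt w 0 9)
... | inj₁ win = let j , pal = palWindow-factorAt w 0 ≤-refl win in factorAt w j 4 , palindromicFactor w pal , ≤-refl
... | inj₂ win = let j , pal = palWindow-factorAt w 0 ≤-refl win in factorAt w j 5 , palindromicFactor w pal , n≤1+n 4

opaque
  periodicWindowIn11 : ∀ l → length l ≡ 11 →
                       PalWindow 5 7 l ⊎ PalWindow 6 6 l ⊎ take 1 (drop 8 l) ≡ take 1 (drop 2 l)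
  periodicWindowIn11 = from-yes (∀-ofLength?
    (λ l → palWindow? 5 7 l ⊎-dec (palWindow? 6 6 l ⊎-dec ≡-dec _≟ᵇ_ (take 1 (drop 8 l)) (take 1 (drop 2 l)))) 11)

palBounded4⇒period6 : ∀ w → PalBounded w 4 → ∀ k → w (k + 2 + 6) ≡ w (k + 2)
palBounded4⇒period6 w bounded k with periodicWindowIn11 (factorAt w k 11) (length-factorAt w k 11)
... | inj₁ win = ⊥-elim (palBounded⇒noPal bounded ≤-refl (palWindow-factorAt w k ≤-refl win))
... | inj₂ (inj₁ win) = ⊥-elim (palBounded⇒noPal bounded (n≤1+n 5) (palWindow-factorAt w k ≤-refl win))
... | inj₂ (inj₂ same) = trans (cong w (+-assoc k 2 6)) (∷-injectiveˡ (begin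
  factorAt w (k + 8) 1                 ≡⟨ take-drop-factorAt w k (m≤m+n 9 2) ⟨
  take 1 (drop 8 (factorAt w k 11))    ≡⟨ same ⟩
  take 1 (drop 2 (factorAt w k 11))    ≡⟨ take-drop-factorAt w k (m≤m+n 3 8) ⟩
  factorAt w (k + 2) 1                 ∎))

palBounded4⇒ultimatelyPeriodic : (w : Word) → PalBounded w 4 → UltimatelyPeriodic w
palBounded4⇒ultimatelyPeriodic w bounded =
  6 , s≤s z≤n , 2 , λ i i≥2 →
    subst (λ j → w (j + 6) ≡ w j) (m∸n+n≡m i≥2) (palBounded4⇒period6 w bounded (i ∸ 2))

periodic001011 : Word
periodic001011 0 = false
periodic001011 1 = false
periodic001011 2 = true
periodic001011 3 = false
periodic001011 4 = true
periodic001011 5 = true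
periodic001011 (suc (suc (suc (suc (suc (suc n)))))) = periodic001011 n

periodic001011-shift : ∀ j n → factorAt periodic001011 (6 + j) n ≡ factorAt periodic001011 j n
periodic001011-shift j zero = refl
periodic001011-shift j (suc n) = cong (periodic001011 j ∷_) (periodic001011-shift (suc j) n)

periodic001011-noPal : ∀ j → ¬ Palindrome (factorAt periodic001011 j 5) × ¬ Palindrome (factorAt periodic001011 j 6)
periodic001011-noPal 0 = (λ ()) , (λ ())
periodic001011-noPal 1 = (λ ()) , (λ ())
periodic001011-noPal 2 = (λ ()) , (λ ())
periodic001011-noPal 3 = (λ ()) , (λ ())
periodic001011-noPal 4 = (λ ()) , (λ ())
periodic001011-noPal 5 = (λ ()) , (λ ())
periodic001011-noPal (suc (suc (suc (suc (suc (suc j)))))) rewrite periodic001011-shift j 5 | periodic001011-shift j 6 =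
  periodic001011-noPal j

periodic001011-palBounded : PalBounded periodic001011 4
periodic001011-palBounded = palBounded 4 (λ j → proj₁ (periodic001011-noPal j)) (λ j → proj₂ (periodic001011-noPal j))

-- The substitution σ and the word ω = φ(σ∞)

data Letter : Set where
  A B C D : Letter

-- σ(A) = ACA, σ(B) = BDB, σ(C) = CAD, σ(D) = CBD. The letter σ x r (resp. σ^[ k ] x r) is the r-th
-- letter of σ(x) (resp. σᵏ(x)); σ x r for r ≥ 3 is junk.
σ : Letter → ℕ → Letter
σ A 1 = C
σ A _ = A
σ B 1 = D
σ B _ = B
σ C 0 = C
σ C 1 = A
σ C _ = D
σ D 0 = C
σ D 1 = B
σ D _ = D

σ^[_] : ℕ → Letter → ℕ → Letter
σ^[ zero ] x r = x
σ^[ suc k ] x r = σ (σ^[ k ] x (r / 3)) (r % 3)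

-- σ(A) begins with A, so each σᵏ(A) is a prefix of σᵏ⁺¹(A), and position n is settled from k = n on.
σ∞ : ℕ → Letter
σ∞ n = σ^[ suc n ] A n

θ : Letter → Letter
θ A = B
θ B = A
θ C = D
θ D = C

[r+q*d]/d≡q : ∀ {d} .{{_ : NonZero d}} r q → r < d → (r + q * d) / d ≡ q
[r+q*d]/d≡q {d} r q r<d = begin
  (r + q * d) / d    ≡⟨ +-distrib-/ r (q * d) fits ⟩
  r / d + q * d / d  ≡⟨ cong₂ _+_ (m<n⇒m/n≡0 r<d) (m*n/n≡m q d) ⟩
  q                  ∎
  where
  fits : r % d + q * d % d < d
  fits = subst (_< d) (sym (trans (cong₂ _+_ (m<n⇒m%n≡m r<d) (m*n%n≡0 q d)) (+-identityʳ r))) r<d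

[r+q*d]%d≡r : ∀ {d} .{{_ : NonZero d}} r q → r < d → (r + q * d) % d ≡ r
[r+q*d]%d≡r {d} r q r<d = trans ([m+kn]%n≡m%n r q d) (m<n⇒m%n≡m r<d)

digit-split : ∀ {d} .{{_ : NonZero d}} r m P → r + m * (d * P) ≡ r % d + (r / d + m * P) * d
digit-split {d} r m P = begin
  r + m * (d * P)                  ≡⟨ cong (_+ m * (d * P)) (m≡m%n+[m/n]*n r d) ⟩
  r % d + r / d * d + m * (d * P)  ≡⟨ solve 5 (λ a b m P d → a :+ b :* d :+ m :* (d :* P) := a :+ (b :+ m :* P) :* d)
                                            refl (r % d) (r / d) m P d ⟩
  r % d + (r / d + m * P) * d      ∎

σ^-suc : ∀ k x q {r} → r < 3 → σ^[ suc k ] x (r + q * 3) ≡ σ (σ^[ k ] x q) r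
σ^-suc k x q {r} r<3 = cong₂ (λ q′ r′ → σ (σ^[ k ] x q′) r′) ([r+q*d]/d≡q r q r<3) ([r+q*d]%d≡r r q r<3)

σ^-A-0 : ∀ k → σ^[ k ] A 0 ≡ A
σ^-A-0 zero = refl
σ^-A-0 (suc k) = cong (λ x → σ x 0) (σ^-A-0 k)

σ^-A-stable : ∀ {k l} n → n ≤ k → n ≤ l → σ^[ k ] A n ≡ σ^[ l ] A n
σ^-A-stable {k} {l} zero _ _ = trans (σ^-A-0 k) (sym (σ^-A-0 l))
σ^-A-stable {suc k} {suc l} (suc n) (s≤s n≤k) (s≤s n≤l) =
  cong (λ x → σ x (suc n % 3)) (σ^-A-stable (suc n / 3) (≤-trans q≤n n≤k) (≤-trans q≤n n≤l))
  where
  q≤n : suc n / 3 ≤ n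
  q≤n = ≤-pred (m/n<m (suc n) 3 (s<s z<s))

σ∞-digit : ∀ m {r} → r < 3 → σ∞ (r + m * 3) ≡ σ (σ∞ m) r
σ∞-digit m {r} r<3 = begin
  σ^[ suc (r + m * 3) ] A (r + m * 3)  ≡⟨ σ^-suc (r + m * 3) A m r<3 ⟩
  σ (σ^[ r + m * 3 ] A m) r            ≡⟨ cong (λ x → σ x r) (σ^-A-stable m (≤-trans (m≤m*n m 3) (m≤n+m (m * 3) r)) (n≤1+n m)) ⟩
  σ (σ∞ m) r                           ∎

σ∞-σ^ : ∀ k m {r} → r < 3 ^ k → σ∞ (r + m * 3 ^ k) ≡ σ^[ k ] (σ∞ m) r
σ∞-σ^ zero m {zero} _ = cong σ∞ (*-identityʳ m)
σ∞-σ^ zero m {suc r} (s<s ())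
σ∞-σ^ (suc k) m {r} r<3^[1+k] = begin
  σ∞ (r + m * (3 * 3 ^ k))                ≡⟨ cong σ∞ (digit-split r m (3 ^ k)) ⟩
  σ∞ (r % 3 + (r / 3 + m * 3 ^ k) * 3)   ≡⟨ σ∞-digit (r / 3 + m * 3 ^ k) (m%n<n r 3) ⟩
  σ (σ∞ (r / 3 + m * 3 ^ k)) (r % 3)     ≡⟨ cong (λ x → σ x (r % 3)) (σ∞-σ^ k m r/3<3^k) ⟩
  σ (σ^[ k ] (σ∞ m) (r / 3)) (r % 3)     ∎
  where
  r/3<3^k : r / 3 < 3 ^ k
  r/3<3^k = m<n*o⇒m/o<n (subst (r <_) (*-comm 3 (3 ^ k)) r<3^[1+k])

block : Letter → List Bool
block A = false ∷ false ∷ false ∷ true ∷ false ∷ false ∷ []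
block B = false ∷ false ∷ true ∷ false ∷ false ∷ false ∷ []
block C = true ∷ true ∷ false ∷ true ∷ true ∷ true ∷ []
block D = true ∷ true ∷ true ∷ false ∷ true ∷ true ∷ []

-- Indexing with junk value false past the end.
_!_ : List Bool → ℕ → Bool
[] ! _ = false
(b ∷ _) ! zero = b
(_ ∷ bs) ! suc r = bs ! r

φ : Letter → ℕ → Bool
φ x r = block x ! r

ω : Word
ω n = φ (σ∞ (n / 6)) (n % 6)

φσ^[_] : ℕ → Letter → ℕ → Bool
φσ^[ k ] x s = φ (σ^[ k ] x (s / 6)) (s % 6)

ω-block : ∀ q {s} → s < 6 → ω (s + q * 6) ≡ φ (σ∞ q) s
ω-block q {s} s<6 = cong₂ (λ q′ s′ → φ (σ∞ q′) s′) ([r+q*d]/d≡q s q s<6) ([r+q*d]%d≡r s q s<6)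

ω-superblock : ∀ k m {s} → s < 6 * 3 ^ k → ω (s + m * (6 * 3 ^ k)) ≡ φσ^[ k ] (σ∞ m) s
ω-superblock k m {s} s<6*3^k = begin
  ω (s + m * (6 * 3 ^ k))               ≡⟨ cong ω (digit-split s m (3 ^ k)) ⟩
  ω (s % 6 + (s / 6 + m * 3 ^ k) * 6)   ≡⟨ ω-block (s / 6 + m * 3 ^ k) (m%n<n s 6) ⟩
  φ (σ∞ (s / 6 + m * 3 ^ k)) (s % 6)    ≡⟨ cong (λ x → φ x (s % 6)) (σ∞-σ^ k m s/6<3^k) ⟩
  φσ^[ k ] (σ∞ m) s                     ∎
  where
  s/6<3^k : s / 6 < 3 ^ k
  s/6<3^k = m<n*o⇒m/o<n (subst (s <_) (*-comm 6 (3 ^ k)) s<6*3^k)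

ω-superblock-cong : ∀ k {m m′ s} → σ∞ m ≡ σ∞ m′ → s < 6 * 3 ^ k →
                    ω (s + m * (6 * 3 ^ k)) ≡ ω (s + m′ * (6 * 3 ^ k))
ω-superblock-cong k {m} {m′} {s} same s< = begin
  ω (s + m * (6 * 3 ^ k))   ≡⟨ ω-superblock k m s< ⟩
  φσ^[ k ] (σ∞ m) s         ≡⟨ cong (λ x → φσ^[ k ] x s) same ⟩
  φσ^[ k ] (σ∞ m′) s        ≡⟨ ω-superblock k m′ s< ⟨
  ω (s + m′ * (6 * 3 ^ k))  ∎

n<3^n : ∀ n → n < 3 ^ n
n<3^n zero = z<s
n<3^n (suc n) = ≤-trans (+-mono-≤ (m^n>0 3 n) (n<3^n n)) (+-monoʳ-≤ (3 ^ n) (m≤m+n (3 ^ n) _))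

n≤6*3^n : ∀ n → n ≤ 6 * 3 ^ n
n≤6*3^n n = ≤-trans (<⇒≤ (n<3^n n)) (m≤n*m (3 ^ n) 6)

-- Closure of ω under reversal

σ-θ : ∀ x a {a′} → a + a′ ≡ 2 → σ (θ x) a ≡ θ (σ x a′)
σ-θ A 0 refl = refl
σ-θ A 1 refl = refl
σ-θ A 2 refl = refl
σ-θ B 0 refl = refl
σ-θ B 1 refl = refl
σ-θ B 2 refl = refl
σ-θ C 0 refl = refl
σ-θ C 1 refl = refl
σ-θ C 2 refl = refl
σ-θ D 0 refl = refl
σ-θ D 1 refl = refl
σ-θ D 2 refl = refl

φ-θ : ∀ x a {a′} → a + a′ ≡ 5 → φ (θ x) a ≡ φ x a′
φ-θ A 0 refl = refl
φ-θ A 1 refl = refl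
φ-θ A 2 refl = refl
φ-θ A 3 refl = refl
φ-θ A 4 refl = refl
φ-θ A 5 refl = refl
φ-θ B 0 refl = refl
φ-θ B 1 refl = refl
φ-θ B 2 refl = refl
φ-θ B 3 refl = refl
φ-θ B 4 refl = refl
φ-θ B 5 refl = refl
φ-θ C 0 refl = refl
φ-θ C 1 refl = refl
φ-θ C 2 refl = refl
φ-θ C 3 refl = refl
φ-θ C 4 refl = refl
φ-θ C 5 refl = refl
φ-θ D 0 refl = refl
φ-θ D 1 refl = refl
φ-θ D 2 refl = refl
φ-θ D 3 refl = refl
φ-θ D 4 refl = refl
φ-θ D 5 refl = refl

r+qd≡pd⇒r≡0 : ∀ {d} .{{_ : NonZero d}} {r q p} → r < d → r + q * d ≡ p * d → r ≡ 0
r+qd≡pd⇒r≡0 {d} {r} {q} {p} r<d eq = begin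
  r                  ≡⟨ [r+q*d]%d≡r r q r<d ⟨
  (r + q * d) % d    ≡⟨ cong (_% d) eq ⟩
  p * d % d          ≡⟨ m*n%n≡0 p d ⟩
  0                  ∎

carry : ∀ {d} .{{_ : NonZero d}} {x y X P} → x < d → y < d → suc (x + y) + X * d ≡ P * d →
        suc (x + y) ≡ d × suc X ≡ P
carry {d} {x} {y} {X} {P} x<d y<d eq with d ≤? suc (x + y)
... | no d≰c = ⊥-elim (1+n≢0 (r+qd≡pd⇒r≡0 {q = X} {P} (≰⇒> d≰c) eq))
... | yes d≤c with m≤n⇒∃[o]m+o≡n d≤c
...   | e , d+e≡c = trans (sym d+e≡c) (trans (cong (d +_) e≡0) (+-identityʳ d)) , *-cancelʳ-≡ (suc X) P d (begin
  suc X * d             ≡⟨ cong (_+ suc X * d) e≡0 ⟨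
  e + suc X * d         ≡⟨ shift ⟩
  suc (x + y) + X * d   ≡⟨ eq ⟩
  P * d                 ∎)
  where
  shift : e + suc X * d ≡ suc (x + y) + X * d
  shift = trans (solve 3 (λ e d X → e :+ (d :+ X :* d) := d :+ e :+ X :* d) refl e d X) (cong (_+ X * d) d+e≡c)
  e<d : e < d
  e<d = +-cancelˡ-< d e d (subst (_< d + d) (sym d+e≡c) (+-mono-≤-< x<d y<d))
  e≡0 : e ≡ 0
  e≡0 = r+qd≡pd⇒r≡0 {q = suc X} {P} e<d (trans shift eq)

complement-digits : ∀ {d} .{{_ : NonZero d}} {r r′ P} → r + suc r′ ≡ P * d →
                    suc (r % d + r′ % d) ≡ d × r / d + suc (r′ / d) ≡ P
complement-digits {d} {r} {r′} eq with carry (m%n<n r d) (m%n<n r′ d) (trans digits eq)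
  where
  digits : suc (r % d + r′ % d) + (r / d + r′ / d) * d ≡ r + suc r′
  digits = begin
    suc (r % d + r′ % d) + (r / d + r′ / d) * d   ≡⟨ solve 5 (λ a a′ b b′ d → con 1 :+ (a :+ a′) :+ (b :+ b′) :* d
                                                                   := con 1 :+ ((a :+ b :* d) :+ (a′ :+ b′ :* d)))
                                                              refl (r % d) (r′ % d) (r / d) (r′ / d) d ⟩
    suc ((r % d + r / d * d) + (r′ % d + r′ / d * d)) ≡⟨ cong suc (cong₂ _+_ (m≡m%n+[m/n]*n r d) (m≡m%n+[m/n]*n r′ d)) ⟨
    suc (r + r′)                                    ≡⟨ +-suc r r′ ⟨
    r + suc r′                                      ∎
... | low , high = low , trans (+-suc (r / d) (r′ / d)) high

σ^-θ : ∀ k x {r r′} → r + suc r′ ≡ 3 ^ k → σ^[ k ] (θ x) r ≡ θ (σ^[ k ] x r′)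
σ^-θ zero x _ = refl
σ^-θ (suc k) x {r} {r′} eq = begin
  σ (σ^[ k ] (θ x) (r / 3)) (r % 3)    ≡⟨ cong (λ y → σ y (r % 3)) (σ^-θ k x (proj₂ digits)) ⟩
  σ (θ (σ^[ k ] x (r′ / 3))) (r % 3)   ≡⟨ σ-θ _ (r % 3) (suc-injective (proj₁ digits)) ⟩
  θ (σ (σ^[ k ] x (r′ / 3)) (r′ % 3))  ∎
  where
  digits = complement-digits (trans eq (*-comm 3 (3 ^ k)))

φσ^-θ : ∀ k x {s s′} → s + suc s′ ≡ 6 * 3 ^ k → φσ^[ k ] (θ x) s ≡ φσ^[ k ] x s′
φσ^-θ k x {s} {s′} eq = begin
  φ (σ^[ k ] (θ x) (s / 6)) (s % 6)    ≡⟨ cong (λ y → φ y (s % 6)) (σ^-θ k x (proj₂ digits)) ⟩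
  φ (θ (σ^[ k ] x (s′ / 6))) (s % 6)   ≡⟨ φ-θ (σ^[ k ] x (s′ / 6)) (s % 6) (suc-injective (proj₁ digits)) ⟩
  φ (σ^[ k ] x (s′ / 6)) (s′ % 6)      ∎
  where
  digits = complement-digits (trans eq (*-comm 6 (3 ^ k)))

ω-mirror : ∀ k {m m′ s s′} → σ∞ m ≡ θ (σ∞ m′) → s + suc s′ ≡ 6 * 3 ^ k →
           ω (s + m * (6 * 3 ^ k)) ≡ ω (s′ + m′ * (6 * 3 ^ k))
ω-mirror k {m} {m′} {s} {s′} mirror eq = begin
  ω (s + m * (6 * 3 ^ k))     ≡⟨ ω-superblock k m (subst (s <_) eq (m<m+n s z<s)) ⟩
  φσ^[ k ] (σ∞ m) s           ≡⟨ cong (λ x → φσ^[ k ] x s) mirror ⟩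
  φσ^[ k ] (θ (σ∞ m′)) s      ≡⟨ φσ^-θ k (σ∞ m′) eq ⟩
  φσ^[ k ] (σ∞ m′) s′         ≡⟨ ω-superblock k m′ (subst (s′ <_) eq (m≤n+m (suc s′) s)) ⟨
  ω (s′ + m′ * (6 * 3 ^ k))   ∎

-- u lies in the superblock φσᵏ(σ∞ 0) = φσᵏ(A); its mirror image lies in φσᵏ(σ∞ 16) = φσᵏ(B).
ω-closedUnderReversal : ClosedUnderReversal ω
ω-closedUnderReversal u (i , occ) = j + 16 * S , (begin
  factorAt ω (j + 16 * S) (length (reverse u))  ≡⟨ cong (factorAt ω (j + 16 * S)) (length-reverse u) ⟩
  factorAt ω (j + 16 * S) ℓ                     ≡⟨ factorAt-reverse (j + 16 * S) i ℓ mirrored ⟩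
  reverse (factorAt ω i ℓ)                      ≡⟨ cong reverse occ ⟩
  reverse u                                     ∎)
  where
  ℓ = length u
  S = 6 * 3 ^ (i + ℓ)
  j = S ∸ (i + ℓ)
  mirrored : ∀ t t′ → t + suc t′ ≡ ℓ → ω (j + 16 * S + t) ≡ ω (i + t′)
  mirrored t t′ eq = begin
    ω (j + 16 * S + t)    ≡⟨ cong ω (solve 3 (λ j S t → j :+ con 16 :* S :+ t := j :+ t :+ con 16 :* S) refl j S t) ⟩
    ω (j + t + 16 * S)    ≡⟨ ω-mirror (i + ℓ) {16} {0} refl complement ⟩
    ω (i + t′ + 0 * S)    ≡⟨ cong ω (+-identityʳ (i + t′)) ⟩
    ω (i + t′)            ∎
    where
    complement : j + t + suc (i + t′) ≡ S
    complement = begin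
      j + t + suc (i + t′)   ≡⟨ solve 4 (λ j t i t′ → j :+ t :+ (con 1 :+ (i :+ t′)) := j :+ (i :+ (t :+ (con 1 :+ t′))))
                                   refl j t i t′ ⟩
      j + (i + (t + suc t′)) ≡⟨ cong (λ n → j + (i + n)) eq ⟩
      j + (i + ℓ)            ≡⟨ m∸n+n≡m (n≤6*3^n (i + ℓ)) ⟩
      S                      ∎

-- Uniform recurrence of ω

A-in-σ³ : ∀ x → ∃ λ r → r < 27 × σ^[ 3 ] x r ≡ A
A-in-σ³ A = 0 , <ᵇ⇒< 0 27 _ , refl
A-in-σ³ B = 10 , <ᵇ⇒< 10 27 _ , refl
A-in-σ³ C = 1 , <ᵇ⇒< 1 27 _ , refl
A-in-σ³ D = 1 , <ᵇ⇒< 1 27 _ , refl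

σ∞-A-in-every-27 : ∀ j → ∃ λ r → r < 27 × σ∞ (r + j * 27) ≡ A
σ∞-A-in-every-27 j = let r , r<27 , isA = A-in-σ³ (σ∞ j) in r , r<27 , trans (σ∞-σ^ 3 j r<27) isA

ω-occurs-in-A-superblock : ∀ k {u i m} → i + length u ≤ 6 * 3 ^ k → σ∞ m ≡ A → OccursAt ω u i →
                           OccursAt ω u (m * (6 * 3 ^ k) + i)
ω-occurs-in-A-superblock k {u} {i} {m} fits isA occ = trans (factorAt-cong (m * S + i) i (length u) agree) occ
  where
  S = 6 * 3 ^ k
  agree : ∀ t → t < length u → ω (m * S + i + t) ≡ ω (i + t)
  agree t t<ℓ = begin
    ω (m * S + i + t)   ≡⟨ cong ω (trans (+-assoc (m * S) i t) (+-comm (m * S) (i + t))) ⟩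
    ω (i + t + m * S)   ≡⟨ ω-superblock-cong k {m} {0} isA (<-≤-trans (+-monoʳ-< i t<ℓ) fits) ⟩
    ω (i + t + 0 * S)   ≡⟨ cong ω (+-identityʳ (i + t)) ⟩
    ω (i + t)           ∎

digit-bounds : ∀ {d} r j S → r < d → j * (d * S) ≤ (r + j * d) * S × (r + j * d) * S ≤ j * (d * S) + d * S
digit-bounds {d} r j S r<d =
  subst (j * (d * S) ≤_) (sym expand) (m≤n+m _ (r * S)) , subst (_≤ j * (d * S) + d * S) (sym expand) upper
  where
  upper : r * S + j * (d * S) ≤ j * (d * S) + d * S
  upper = subst (r * S + j * (d * S) ≤_) (+-comm (d * S) (j * (d * S))) (+-monoˡ-≤ (j * (d * S)) (*-monoˡ-≤ S (<⇒≤ r<d)))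
  expand : (r + j * d) * S ≡ r * S + j * (d * S)
  expand = solve 4 (λ r j d S → (r :+ j :* d) :* S := r :* S :+ j :* (d :* S)) refl r j d S

nextMultiple-bounds : ∀ M .{{_ : NonZero M}} i x → suc (i / M) * M ≤ x × x ≤ suc (i / M) * M + M →
                      i ≤ x × x ≤ i + (M + M)
nextMultiple-bounds M i x (lo , hi) =
  ≤-trans (<⇒≤ i<) lo , ≤-trans hi (subst (_≤ i + (M + M)) rearrange (+-monoˡ-≤ (M + M) (m/n*n≤m i M)))
  where
  i< : i < suc (i / M) * M
  i< = subst (_< M + i / M * M) (sym (m≡m%n+[m/n]*n i M)) (+-monoˡ-< (i / M * M) (m%n<n i M))
  rearrange : i / M * M + (M + M) ≡ suc (i / M) * M + M
  rearrange = solve 2 (λ q M → q :+ (M :+ M) := M :+ q :+ M) refl (i / M * M) M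

ω-uniformlyRecurrent : UniformlyRecurrent ω
ω-uniformlyRecurrent u (i , occ) = i + (M + M) , nearby
  where
  k = i + length u
  S = 6 * 3 ^ k
  M = 27 * S
  instance
    M≢0 : NonZero M
    M≢0 = m*n≢0 27 S {{_}} {{m*n≢0 6 (3 ^ k) {{_}} {{m^n≢0 3 k}}}}
  nearby : ∀ i₀ → ∃ λ p → i₀ ≤ p × p ≤ i₀ + (i + (M + M)) × OccursAt ω u p
  nearby i₀ =
    x + i , ≤-trans after (m≤m+n x i) , within , ω-occurs-in-A-superblock k {m = r + j * 27} (n≤6*3^n k) isA occ
    where
    j = suc (i₀ / M)
    r = proj₁ (σ∞-A-in-every-27 j)
    r<27 = proj₁ (proj₂ (σ∞-A-in-every-27 j))
    isA = proj₂ (proj₂ (σ∞-A-in-every-27 j))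
    x = (r + j * 27) * S
    after = proj₁ (nextMultiple-bounds M i₀ x (digit-bounds r j S r<27))
    before = proj₂ (nextMultiple-bounds M i₀ x (digit-bounds r j S r<27))
    within : x + i ≤ i₀ + (i + (M + M))
    within = subst (x + i ≤_) (solve 3 (λ i₀ M i → i₀ :+ (M :+ M) :+ i := i₀ :+ (i :+ (M :+ M))) refl i₀ M i)
               (+-monoˡ-≤ i before)

-- Aperiodicity of ω

N≤n⇒N≤r+n*d : ∀ {N n} r d .{{_ : NonZero d}} → N ≤ n → N ≤ r + n * d
N≤n⇒N≤r+n*d {n = n} r d N≤n = ≤-trans N≤n (≤-trans (m≤m*n n d) (m≤n+m (n * d) r))

PeriodFrom : {X : Set} → (ℕ → X) → ℕ → ℕ → Set
PeriodFrom f p N = ∀ n → n ≥ N → f (n + p) ≡ f n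

periodFrom-* : ∀ {X : Set} {f : ℕ → X} {p N} k → PeriodFrom f p N → PeriodFrom f (k * p) N
periodFrom-* {f = f} zero per n _ = cong f (+-identityʳ n)
periodFrom-* {f = f} {p} (suc k) per n n≥N = begin
  f (n + (p + k * p))  ≡⟨ cong f (+-assoc n p (k * p)) ⟨
  f (n + p + k * p)    ≡⟨ periodFrom-* k per (n + p) (≤-trans n≥N (m≤m+n n p)) ⟩
  f (n + p)            ≡⟨ per n n≥N ⟩
  f n                  ∎

σ⁻¹ : Letter → Letter → Letter
σ⁻¹ A _ = A
σ⁻¹ B _ = B
σ⁻¹ C A = C
σ⁻¹ _ _ = D

σ⁻¹-σ : ∀ x → σ⁻¹ (σ x 0) (σ x 1) ≡ x
σ⁻¹-σ A = refl
σ⁻¹-σ B = refl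
σ⁻¹-σ C = refl
σ⁻¹-σ D = refl

σ-injective : ∀ {x y} → σ x 0 ≡ σ y 0 → σ x 1 ≡ σ y 1 → x ≡ y
σ-injective {x} {y} e₀ e₁ = trans (sym (σ⁻¹-σ x)) (trans (cong₂ σ⁻¹ e₀ e₁) (σ⁻¹-σ y))

φ⁻¹ : Bool → Bool → Letter
φ⁻¹ false false = A
φ⁻¹ false true = B
φ⁻¹ true false = C
φ⁻¹ true true = D

φ⁻¹-φ : ∀ x → φ⁻¹ (φ x 0) (φ x 2) ≡ x
φ⁻¹-φ A = refl
φ⁻¹-φ B = refl
φ⁻¹-φ C = refl
φ⁻¹-φ D = refl

φ-injective : ∀ {x y} → φ x 0 ≡ φ y 0 → φ x 2 ≡ φ y 2 → x ≡ y
φ-injective {x} {y} e₀ e₂ = trans (sym (φ⁻¹-φ x)) (trans (cong₂ φ⁻¹ e₀ e₂) (φ⁻¹-φ y))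

data IsAB : Letter → Set where
  isA : IsAB A
  isB : IsAB B

σ-first≢D : ∀ y → σ y 0 ≢ D
σ-first≢D A ()
σ-first≢D B ()
σ-first≢D C ()
σ-first≢D D ()

σ-last≢C : ∀ y → σ y 2 ≢ C
σ-last≢C A ()
σ-last≢C B ()
σ-last≢C C ()
σ-last≢C D ()

σ-last≡σ-first⇒IsAB : ∀ x y → σ x 2 ≡ σ y 0 → IsAB x
σ-last≡σ-first⇒IsAB A y _ = isA
σ-last≡σ-first⇒IsAB B y _ = isB
σ-last≡σ-first⇒IsAB C y eq = ⊥-elim (σ-first≢D y (sym eq))
σ-last≡σ-first⇒IsAB D y eq = ⊥-elim (σ-first≢D y (sym eq))

σ-first≡σ-last⇒IsAB : ∀ x y → σ x 0 ≡ σ y 2 → IsAB x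
σ-first≡σ-last⇒IsAB A y _ = isA
σ-first≡σ-last⇒IsAB B y _ = isB
σ-first≡σ-last⇒IsAB C y eq = ⊥-elim (σ-last≢C y (sym eq))
σ-first≡σ-last⇒IsAB D y eq = ⊥-elim (σ-last≢C y (sym eq))

IsAB⇒¬IsAB-σ₁ : ∀ {x} → IsAB x → ¬ IsAB (σ x 1)
IsAB⇒¬IsAB-σ₁ isA ()
IsAB⇒¬IsAB-σ₁ isB ()

σ∞-¬eventuallyAB : ∀ N → ¬ (∀ n → n ≥ N → IsAB (σ∞ n))
σ∞-¬eventuallyAB N allAB =
  IsAB⇒¬IsAB-σ₁ (allAB N ≤-refl) (subst IsAB (σ∞-digit N (s<s z<s)) (allAB (1 + N * 3) (N≤n⇒N≤r+n*d 1 3 ≤-refl)))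

σ∞-periodFrom-/3 : ∀ {p N} → PeriodFrom σ∞ (p * 3) N → PeriodFrom σ∞ p N
σ∞-periodFrom-/3 {p} {N} per n n≥N = σ-injective (sameDigit 0 z<s) (sameDigit 1 (s<s z<s))
  where
  sameDigit : ∀ r → r < 3 → σ (σ∞ (n + p)) r ≡ σ (σ∞ n) r
  sameDigit r r<3 = begin
    σ (σ∞ (n + p)) r          ≡⟨ σ∞-digit (n + p) r<3 ⟨
    σ∞ (r + (n + p) * 3)      ≡⟨ cong σ∞ (solve 3 (λ r n p → r :+ (n :+ p) :* con 3 := r :+ n :* con 3 :+ p :* con 3) refl r n p) ⟩
    σ∞ (r + n * 3 + p * 3)    ≡⟨ per (r + n * 3) (N≤n⇒N≤r+n*d r 3 n≥N) ⟩
    σ∞ (r + n * 3)            ≡⟨ σ∞-digit n r<3 ⟩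
    σ (σ∞ n) r                ∎

σ∞-periodFrom-1+3m⇒IsAB : ∀ {m N} → PeriodFrom σ∞ (1 + m * 3) N → ∀ n → n ≥ N → IsAB (σ∞ n)
σ∞-periodFrom-1+3m⇒IsAB {m} {N} per n n≥N = σ-last≡σ-first⇒IsAB (σ∞ n) (σ∞ (suc (n + m))) (begin
  σ (σ∞ n) 2                     ≡⟨ σ∞-digit n (s<s (s<s z<s)) ⟨
  σ∞ (2 + n * 3)                 ≡⟨ per (2 + n * 3) (N≤n⇒N≤r+n*d 2 3 n≥N) ⟨
  σ∞ (2 + n * 3 + (1 + m * 3))   ≡⟨ cong σ∞ (solve 2 (λ n m → con 2 :+ n :* con 3 :+ (con 1 :+ m :* con 3)
                                                          := (con 1 :+ (n :+ m)) :* con 3) refl n m) ⟩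
  σ∞ (suc (n + m) * 3)           ≡⟨ σ∞-digit (suc (n + m)) z<s ⟩
  σ (σ∞ (suc (n + m))) 0         ∎)

σ∞-periodFrom-2+3m⇒IsAB : ∀ {m N} → PeriodFrom σ∞ (2 + m * 3) N → ∀ n → n ≥ N → IsAB (σ∞ n)
σ∞-periodFrom-2+3m⇒IsAB {m} {N} per n n≥N = σ-first≡σ-last⇒IsAB (σ∞ n) (σ∞ (n + m)) (begin
  σ (σ∞ n) 0                     ≡⟨ σ∞-digit n z<s ⟨
  σ∞ (n * 3)                     ≡⟨ per (n * 3) (N≤n⇒N≤r+n*d 0 3 n≥N) ⟨
  σ∞ (n * 3 + (2 + m * 3))       ≡⟨ cong σ∞ (solve 2 (λ n m → n :* con 3 :+ (con 2 :+ m :* con 3)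
                                                          := con 2 :+ (n :+ m) :* con 3) refl n m) ⟩
  σ∞ (2 + (n + m) * 3)           ≡⟨ σ∞-digit (n + m) (s<s (s<s z<s)) ⟩
  σ (σ∞ (n + m)) 2               ∎)

σ∞-aperiodic : ∀ p → p ≥ 1 → ∀ N → ¬ PeriodFrom σ∞ p N
σ∞-aperiodic = <-rec (λ p → p ≥ 1 → ∀ N → ¬ PeriodFrom σ∞ p N) step
  where
  step : ∀ p → (∀ {q} → q < p → q ≥ 1 → ∀ N → ¬ PeriodFrom σ∞ q N) →
         p ≥ 1 → ∀ N → ¬ PeriodFrom σ∞ p N
  step p smaller p≥1 N per with p divMod 3
  ... | result zero zero refl = n≮0 p≥1
  ... | result (suc q) zero refl = smaller (m<m*n (suc q) 3 (s<s z<s)) (s≤s z≤n) N (σ∞-periodFrom-/3 per)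
  ... | result q (suc zero) refl = σ∞-¬eventuallyAB N (σ∞-periodFrom-1+3m⇒IsAB {q} per)
  ... | result q (suc (suc zero)) refl = σ∞-¬eventuallyAB N (σ∞-periodFrom-2+3m⇒IsAB {q} per)

ω-periodFrom⇒σ∞-periodFrom : ∀ {p N} → PeriodFrom ω p N → PeriodFrom σ∞ p N
ω-periodFrom⇒σ∞-periodFrom {p} {N} per n n≥N = φ-injective (sameBit 0 z<s) (sameBit 2 (s<s (s<s z<s)))
  where
  sameBit : ∀ s → s < 6 → φ (σ∞ (n + p)) s ≡ φ (σ∞ n) s
  sameBit s s<6 = begin
    φ (σ∞ (n + p)) s         ≡⟨ ω-block (n + p) s<6 ⟨
    ω (s + (n + p) * 6)      ≡⟨ cong ω (solve 3 (λ s n p → s :+ (n :+ p) :* con 6 := s :+ n :* con 6 :+ con 6 :* p) refl s n p) ⟩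
    ω (s + n * 6 + 6 * p)    ≡⟨ periodFrom-* 6 per (s + n * 6) (N≤n⇒N≤r+n*d s 6 n≥N) ⟩
    ω (s + n * 6)            ≡⟨ ω-block n s<6 ⟩
    φ (σ∞ n) s               ∎

ω-aperiodic : Aperiodic ω
ω-aperiodic (p , p≥1 , N , per) = σ∞-aperiodic p p≥1 N (ω-periodFrom⇒σ∞-periodFrom per)

-- Palindromes of ω

data Adjacent : Letter → Letter → Set where
  AC : Adjacent A C
  CA : Adjacent C A
  BD : Adjacent B D
  DB : Adjacent D B
  AD : Adjacent A D
  DA : Adjacent D A
  BC : Adjacent B C
  CB : Adjacent C B

adjacent-σ₀₁ : ∀ x → Adjacent (σ x 0) (σ x 1)
adjacent-σ₀₁ A = AC
adjacent-σ₀₁ B = BD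
adjacent-σ₀₁ C = CA
adjacent-σ₀₁ D = CB

adjacent-σ₁₂ : ∀ x → Adjacent (σ x 1) (σ x 2)
adjacent-σ₁₂ A = CA
adjacent-σ₁₂ B = DB
adjacent-σ₁₂ C = AD
adjacent-σ₁₂ D = BD

adjacent-σ₂₀ : ∀ {x y} → Adjacent x y → Adjacent (σ x 2) (σ y 0)
adjacent-σ₂₀ AC = AC
adjacent-σ₂₀ CA = DA
adjacent-σ₂₀ BD = BC
adjacent-σ₂₀ DB = DB
adjacent-σ₂₀ AD = AC
adjacent-σ₂₀ DA = DA
adjacent-σ₂₀ BC = BC
adjacent-σ₂₀ CB = DB

adjacent-σ∞ : ∀ q → Adjacent (σ∞ q) (σ∞ (suc q))
adjacent-σ∞ = <-rec (λ q → Adjacent (σ∞ q) (σ∞ (suc q))) step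
  where
  step : ∀ q → (∀ {m} → m < q → Adjacent (σ∞ m) (σ∞ (suc m))) → Adjacent (σ∞ q) (σ∞ (suc q))
  step q smaller with q divMod 3
  ... | result m zero refl =
    subst₂ Adjacent (sym (σ∞-digit m z<s)) (sym (σ∞-digit m (s<s z<s))) (adjacent-σ₀₁ (σ∞ m))
  ... | result m (suc zero) refl =
    subst₂ Adjacent (sym (σ∞-digit m (s<s z<s))) (sym (σ∞-digit m (s<s (s<s z<s)))) (adjacent-σ₁₂ (σ∞ m))
  ... | result m (suc (suc zero)) refl =
    subst₂ Adjacent (sym (σ∞-digit m (s<s (s<s z<s)))) (sym (σ∞-digit (suc m) z<s))
      (adjacent-σ₂₀ (smaller (s≤s (≤-trans (m≤m*n m 3) (n≤1+n (m * 3))))))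

noLongPal? : ∀ x y → Dec (¬ PalWindow 6 6 (block x ++ block y) × ¬ PalWindow 7 6 (block x ++ block y))
noLongPal? x y = ¬? (palWindow? 6 6 _) ×-dec ¬? (palWindow? 7 6 _)

noLongPal : ∀ {x y} → Adjacent x y → ¬ PalWindow 6 6 (block x ++ block y) × ¬ PalWindow 7 6 (block x ++ block y)
noLongPal AC = from-yes (noLongPal? A C)
noLongPal CA = from-yes (noLongPal? C A)
noLongPal BD = from-yes (noLongPal? B D)
noLongPal DB = from-yes (noLongPal? D B)
noLongPal AD = from-yes (noLongPal? A D)
noLongPal DA = from-yes (noLongPal? D A)
noLongPal BC = from-yes (noLongPal? B C)
noLongPal CB = from-yes (noLongPal? C B)

factorAt-φ : ∀ x → factorAt (φ x) 0 6 ≡ block x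
factorAt-φ A = refl
factorAt-φ B = refl
factorAt-φ C = refl
factorAt-φ D = refl

ω-factor-block : ∀ q → factorAt ω (q * 6) 6 ≡ block (σ∞ q)
ω-factor-block q =
  trans (factorAt-cong {ω} {φ (σ∞ q)} (q * 6) 0 6 (λ t t<6 → trans (cong ω (+-comm (q * 6) t)) (ω-block q t<6)))
        (factorAt-φ (σ∞ q))

ω-factor-adjacentBlocks : ∀ q → factorAt ω (q * 6) 12 ≡ block (σ∞ q) ++ block (σ∞ (suc q))
ω-factor-adjacentBlocks q = begin
  factorAt ω (q * 6) (6 + 6)                         ≡⟨ factorAt-++ ω (q * 6) 6 6 ⟩
  factorAt ω (q * 6) 6 ++ factorAt ω (q * 6 + 6) 6   ≡⟨ cong (λ j → factorAt ω (q * 6) 6 ++ factorAt ω j 6) (+-comm (q * 6) 6) ⟩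
  factorAt ω (q * 6) 6 ++ factorAt ω (suc q * 6) 6   ≡⟨ cong₂ _++_ (ω-factor-block q) (ω-factor-block (suc q)) ⟩
  block (σ∞ q) ++ block (σ∞ (suc q))                  ∎

ω-palindrome⇒palWindow : ∀ {n} j → n ≤ 7 → Palindrome (factorAt ω j n) →
                         ∃ λ q → PalWindow n 6 (block (σ∞ q) ++ block (σ∞ (suc q)))
ω-palindrome⇒palWindow {n} j n≤7 pal with j divMod 6
... | result q s refl = q , s , subst Palindrome window pal
  where
  window : factorAt ω (toℕ s + q * 6) n ≡ take n (drop (toℕ s) (block (σ∞ q) ++ block (σ∞ (suc q))))
  window = begin
    factorAt ω (toℕ s + q * 6) n                   ≡⟨ cong (λ i → factorAt ω i n) (+-comm (toℕ s) (q * 6)) ⟩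
    factorAt ω (q * 6 + toℕ s) n                   ≡⟨ take-drop-factorAt ω (q * 6) (+-mono-≤ (≤-pred (toℕ<n s)) n≤7) ⟨
    take n (drop (toℕ s) (factorAt ω (q * 6) 12))  ≡⟨ cong (λ l → take n (drop (toℕ s) l)) (ω-factor-adjacentBlocks q) ⟩
    take n (drop (toℕ s) (block (σ∞ q) ++ block (σ∞ (suc q)))) ∎

ω-palBounded : PalBounded ω 5
ω-palBounded = palBounded 5
  (λ j pal → let q , win = ω-palindrome⇒palWindow j (n≤1+n 6) pal in proj₁ (noLongPal (adjacent-σ∞ q)) win)
  (λ j pal → let q , win = ω-palindrome⇒palWindow j ≤-refl pal in proj₂ (noLongPal (adjacent-σ∞ q)) win)

ω-pal5 : ∃ λ u → PalFactor ω u × length u ≡ 5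
ω-pal5 = factorAt ω 1 5 , palindromicFactor ω {1} {5} refl , refl

mainTheorem9 : ((w : Word) → ∃ λ u → PalFactor w u × length u > 3)
    × ((∃ λ w → PalBounded w 4)
    × ((w : Word) → PalBounded w 4 → UltimatelyPeriodic w))
    × (∃ λ w → UniformlyRecurrent w × Aperiodic w × ClosedUnderReversal w
    × (∃ λ u → PalFactor w u × length u ≡ 5) × PalBounded w 5)
mainTheorem9 =
  longPalFactor ,
  ((periodic001011 , periodic001011-palBounded) , palBounded4⇒ultimatelyPeriodic) ,
  (ω , ω-uniformlyRecurrent , ω-aperiodic , ω-closedUnderReversal , ω-pal5 , ω-palBounded)
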